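{- Let $\mathcal{L}:\mathcal{S}\to\mathcal{T}$ be a diagrammatic logic, i.e. a pushout-preserving functor between two categories $\mathcal{S}$, $\mathcal{T}$ that have pushouts. Let $l:K\to H$, $r:K\to C$ be a span in $\mathcal{S}$, and let $$\begin{array}{ccc} K & \xrightarrow{\;r\;} & C\\ {\scriptstyle l}\downarrow & & \downarrow{\scriptstyle c}\\ H & \xrightarrow{\;h\;} & P\end{array}$$ be a pushout square in $\mathcal{S}$ (so $h\circ l=c\circ r$), where $h$ is a pleomorphism. (Thus $(c,h)$ is a deduction rule with hypothesis $H$ and conclusion $C$.) Let $\sigma_H:H\to \Sigma_H$ be a morphism in $\mathcal{S}$, and suppose given a pleopushout under $(l,r)$ extending $\sigma_H$: morphisms $\sigma_K:K\to\Sigma_K$, $l_1:\Sigma_K\to\Sigma_H$, $r_1:\Sigma_K\to\Sigma_C$ and $\sigma_C:C\to\Sigma_C$ in $\mathcal{S}$ such that $l_1$ is a pleomorphism, $l_1\circ\sigma_K=\sigma_H\circ l$, and the square formed by $r:K\to C$, $\sigma_K:K\to\Sigma_K$, $\sigma_C:C\to\Sigma_C$, $r_1:\Sigma_K\to\Sigma_C$ (with $\sigma_C\circ r=r_1\circ\sigma_K$) is a pushout. Finally let $h_1:\Sigma_H\to\Sigma_P$, $c_1:\Sigma_C\to\Sigma_P$ be a pushout of the span $(l_1,r_1)$, so $h_1\circ l_1=c_1\circ r_1$. Then there is a unique morphism $\sigma_P:P\to\Sigma_P$ such that $\sigma_P\circ h=h_1\circ\sigma_H$ and $\sigma_P\circ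 c=c_1\circ\sigma_C$. Moreover: (i) the following four commutative squares are pushouts: the square $(l,r,h,c)$ on $K,H,C,P$; the square $(l_1,r_1,h_1,c_1)$ on $\Sigma_K,\Sigma_H,\Sigma_C,\Sigma_P$; the square $(r,\sigma_K,\sigma_C,r_1)$ on $K,C,\Sigma_K,\Sigma_C$; and the square on $H,P,\Sigma_H,\Sigma_P$ formed by $h:H\to P$, $\sigma_H:H\to\Sigma_H$, $\sigma_P:P\to\Sigma_P$, $h_1:\Sigma_H\to\Sigma_P$; (ii) $h$, $l_1$, $r_1$, $h_1$ and $c_1$ are pleomorphisms. Finally, if $\sigma_H$ is an instance of $H$ in some specification $\Sigma$ (i.e. $\Sigma_H$ is pleoequivalent to $\Sigma$), then $\sigma_C:C\to\Sigma_C$ is an instance of $C$ in $\Sigma$ (i.e. $\Sigma_C$ is pleoequivalent to $\Sigma$).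
   Context: A diagrammatic logic is a pushout-preserving functor $\mathcal{L}:\mathcal{S}\to\mathcal{T}$ between two categories with pushouts; objects of $\mathcal{S}$ are called specifications and objects of $\mathcal{T}$ theories. A morphism $\tau$ of $\mathcal{S}$ is a pleomorphism if $\mathcal{L}\tau$ is an isomorphism in $\mathcal{T}$. Two specifications $\Sigma,\Sigma'$ are pleoequivalent if $\mathcal{L}\Sigma\cong\mathcal{L}\Sigma'$ in $\mathcal{T}$. An instance of a specification $\Sigma_1$ in a specification $\Sigma_2$ is a morphism $\Sigma_1\to\Sigma_2'$ in $\mathcal{S}$ where $\Sigma_2'$ is pleoequivalent to $\Sigma_2$. A deduction rule is a cospan $C\xrightarrow{c}P\xleftarrow{h}H$ in $\mathcal{S}$ with $h$ a pleomorphism. A pleopushout under a span $(l:K\to H,\ r:K\to C)$ is a diagram consisting of a commutative square $l_1\circ\sigma_K=\sigma_H\circ l$ with $l_1:\Sigma_K\to\Sigma_H$ a pleomorphism, together with a pushout square $\sigma_C\circ r=r_1\circ\sigma_K$. -}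

module Defs where

open import Level using (Level; _⊔_) renaming (suc to lsuc)
open import Data.Product using (Σ; _×_; _,_)
open import Relation.Binary.Structures using (IsEquivalence)

record Category (o ℓ e : Level) : Set (lsuc (o ⊔ ℓ ⊔ e)) where
  infixr 9 _∘_
  infix  4 _≈_
  field
    Obj   : Set o
    Hom   : Obj → Obj → Set ℓ
    _≈_   : ∀ {A B} → Hom A B → Hom A B → Set e
    ≈-equiv : ∀ {A B} → IsEquivalence (_≈_ {A} {B})
    id    : ∀ {A} → Hom A A
    _∘_   : ∀ {A B C} → Hom B C → Hom A B → Hom A C
    assoc : ∀ {A B C D} {f : Hom A B} {g : Hom B C} {h : Hom C D} →
            (h ∘ g) ∘ f ≈ h ∘ (g ∘ f)
    identityˡ : ∀ {A B} {f : Hom A B} → id ∘ f ≈ f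
    identityʳ : ∀ {A B} {f : Hom A B} → f ∘ id ≈ f
    ∘-resp-≈  : ∀ {A B C} {f h : Hom B C} {g i : Hom A B} →
                f ≈ h → g ≈ i → f ∘ g ≈ h ∘ i

module _ {o ℓ e : Level} (𝒞 : Category o ℓ e) where
  open Category 𝒞

  IsIso : ∀ {A B} → Hom A B → Set (ℓ ⊔ e)
  IsIso {A} {B} f = Σ (Hom B A) λ g → (g ∘ f ≈ id) × (f ∘ g ≈ id)

  _≅_ : Obj → Obj → Set (ℓ ⊔ e)
  A ≅ B = Σ (Hom A B) λ f → IsIso f

  record IsPushout {A B C D : Obj} (f : Hom A B) (g : Hom A C)
                   (i₁ : Hom B D) (i₂ : Hom C D) : Set (o ⊔ ℓ ⊔ e) where
    field
      commute   : i₁ ∘ f ≈ i₂ ∘ g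
      universal : ∀ {X} (u : Hom B X) (v : Hom C X) → u ∘ f ≈ v ∘ g → Hom D X
      universal-β₁ : ∀ {X} {u : Hom B X} {v : Hom C X} (eq : u ∘ f ≈ v ∘ g) →
                     universal u v eq ∘ i₁ ≈ u
      universal-β₂ : ∀ {X} {u : Hom B X} {v : Hom C X} (eq : u ∘ f ≈ v ∘ g) →
                     universal u v eq ∘ i₂ ≈ v
      unique    : ∀ {X} {u : Hom B X} {v : Hom C X} (eq : u ∘ f ≈ v ∘ g)
                  (w : Hom D X) → w ∘ i₁ ≈ u → w ∘ i₂ ≈ v → w ≈ universal u v eq

  HasPushouts : Set (o ⊔ ℓ ⊔ e)
  HasPushouts = ∀ {A B C} (f : Hom A B) (g : Hom A C) →
    Σ Obj λ D → Σ (Hom B D) λ i₁ → Σ (Hom C D) λ i₂ → IsPushout f g i₁ i₂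

record Functor {o ℓ e o′ ℓ′ e′ : Level}
               (𝒞 : Category o ℓ e) (𝒟 : Category o′ ℓ′ e′)
               : Set (o ⊔ ℓ ⊔ e ⊔ o′ ⊔ ℓ′ ⊔ e′) where
  private
    module C = Category 𝒞
    module D = Category 𝒟
  field
    F₀ : C.Obj → D.Obj
    F₁ : ∀ {A B} → C.Hom A B → D.Hom (F₀ A) (F₀ B)
    identity     : ∀ {A} → F₁ (C.id {A}) D.≈ D.id
    homomorphism : ∀ {A B C} {f : C.Hom A B} {g : C.Hom B C} →
                   F₁ (g C.∘ f) D.≈ F₁ g D.∘ F₁ f
    F-resp-≈     : ∀ {A B} {f g : C.Hom A B} → f C.≈ g → F₁ f D.≈ F₁ g

record DiagrammaticLogic (o ℓ e o′ ℓ′ e′ : Level)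
       : Set (lsuc (o ⊔ ℓ ⊔ e ⊔ o′ ⊔ ℓ′ ⊔ e′)) where
  field
    𝒮 : Category o ℓ e
    𝒯 : Category o′ ℓ′ e′
    𝒮-pushouts : HasPushouts 𝒮
    𝒯-pushouts : HasPushouts 𝒯
    𝓛 : Functor 𝒮 𝒯
  open Category 𝒮
  open Functor 𝓛
  field
    preserves-pushouts : ∀ {A B C D} {f : Hom A B} {g : Hom A C}
                           {i₁ : Hom B D} {i₂ : Hom C D} →
                         IsPushout 𝒮 f g i₁ i₂ →
                         IsPushout 𝒯 (F₁ f) (F₁ g) (F₁ i₁) (F₁ i₂)

  IsPleomorphism : ∀ {A B} → Hom A B → Set (ℓ′ ⊔ e′)
  IsPleomorphism τ = IsIso 𝒯 (F₁ τ)

  Pleoequivalent : Obj → Obj → Set (ℓ′ ⊔ e′)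
  Pleoequivalent A B = _≅_ 𝒯 (F₀ A) (F₀ B)

  IsInstanceIn : ∀ {Σ₁ Σ₂′} → Hom Σ₁ Σ₂′ → Obj → Set (ℓ′ ⊔ e′)
  IsInstanceIn {Σ₂′ = Σ₂′} σ Σ₂ = Pleoequivalent Σ₂′ Σ₂

module Submission where

-- The morphism σP is the mediating map out of the pushout P of
-- (l , r) induced by h₁ ∘ σH and c₁ ∘ σC (these agree on K because both
-- Σ-squares commute); uniqueness is the uniqueness part of that pushout.
-- The square (h , σH , σP , h₁) is a pushout by the two halves of the
-- pasting lemma: pasting the pushouts (r , σK) and (l₁ , r₁) gives a pushout
-- of (l₁ ∘ σK , r) = (σH ∘ l , r), and cancelling the pushout (l , r) from it
-- leaves the square on H, P, ΣH, ΣP.  For the pleomorphisms we use that 𝓛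
-- preserves pushouts and that in any category the pushout of an isomorphism
-- is an isomorphism (giving c₁ from l₁ and h₁ from h), while r₁ follows by
-- 2-out-of-3 from 𝓛c₁ ∘ 𝓛r₁ ≈ 𝓛h₁ ∘ 𝓛l₁.  Finally ΣC ≅ ΣP ≅ ΣH in 𝒯 via
-- 𝓛c₁ and 𝓛h₁, which transports the instance property from σH to σC.

open import Defs
open import Level using (Level)
open import Data.Product using (Σ; _×_; _,_)
open import Relation.Binary.Structures using (IsEquivalence)
open import Relation.Binary.Bundles using (Setoid)
import Relation.Binary.Reasoning.Setoid as SetoidReasoning

module CategoryFacts {o ℓ e} (𝒞 : Category o ℓ e) where
  open Category 𝒞

  module ≈ {A B} = IsEquivalence (≈-equiv {A} {B})

  hom-setoid : Obj → Obj → Setoid ℓ e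
  hom-setoid A B = record { Carrier = Hom A B ; _≈_ = _≈_ ; isEquivalence = ≈-equiv }

  open module HomReasoning {A} {B} = SetoidReasoning (hom-setoid A B) public

  ∘-congˡ : ∀ {A B C} {k : Hom B C} {f g : Hom A B} → f ≈ g → k ∘ f ≈ k ∘ g
  ∘-congˡ p = ∘-resp-≈ ≈.refl p

  ∘-congʳ : ∀ {A B C} {f g : Hom B C} {k : Hom A B} → f ≈ g → f ∘ k ≈ g ∘ k
  ∘-congʳ p = ∘-resp-≈ p ≈.refl

  pull : ∀ {A B C D} {x : Hom C D} {k : Hom B C} {f : Hom A B} {g : Hom A C} →
         k ∘ f ≈ g → (x ∘ k) ∘ f ≈ x ∘ g
  pull p = ≈.trans assoc (∘-congˡ p)

  pull-through : ∀ {A B B′ C D} {x : Hom C D} {k : Hom B C} {y : Hom B′ D}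
                 {m : Hom B B′} {f : Hom A B} → x ∘ k ≈ y ∘ m → (x ∘ k) ∘ f ≈ y ∘ (m ∘ f)
  pull-through p = ≈.trans (∘-congʳ p) assoc

  iso-∘ : ∀ {A B C} {f : Hom A B} {g : Hom B C} → IsIso 𝒞 f → IsIso 𝒞 g → IsIso 𝒞 (g ∘ f)
  iso-∘ {f = f} {g} (f⁻¹ , f⁻¹f , ff⁻¹) (g⁻¹ , g⁻¹g , gg⁻¹) = f⁻¹ ∘ g⁻¹ , left , right
    where
    left : (f⁻¹ ∘ g⁻¹) ∘ (g ∘ f) ≈ id
    left = begin
      (f⁻¹ ∘ g⁻¹) ∘ (g ∘ f) ≈⟨ pull (≈.sym assoc) ⟩
      f⁻¹ ∘ ((g⁻¹ ∘ g) ∘ f) ≈⟨ ∘-congˡ (≈.trans (∘-congʳ g⁻¹g) identityˡ) ⟩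
      f⁻¹ ∘ f               ≈⟨ f⁻¹f ⟩
      id                    ∎
    right : (g ∘ f) ∘ (f⁻¹ ∘ g⁻¹) ≈ id
    right = begin
      (g ∘ f) ∘ (f⁻¹ ∘ g⁻¹) ≈⟨ pull (≈.sym assoc) ⟩
      g ∘ ((f ∘ f⁻¹) ∘ g⁻¹) ≈⟨ ∘-congˡ (≈.trans (∘-congʳ ff⁻¹) identityˡ) ⟩
      g ∘ g⁻¹               ≈⟨ gg⁻¹ ⟩
      id                    ∎

  iso-cancelˡ : ∀ {A B C} {f : Hom A B} {g : Hom B C} {k : Hom A C} →
                IsIso 𝒞 g → IsIso 𝒞 k → g ∘ f ≈ k → IsIso 𝒞 f
  iso-cancelˡ {f = f} {g} {k} (g⁻¹ , g⁻¹g , _) (k⁻¹ , k⁻¹k , kk⁻¹) gf≈k =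
    k⁻¹ ∘ g , ≈.trans (pull gf≈k) k⁻¹k , right
    where
    f≈g⁻¹k : f ≈ g⁻¹ ∘ k
    f≈g⁻¹k = begin
      f               ≈⟨ ≈.sym identityˡ ⟩
      id ∘ f          ≈⟨ ∘-congʳ (≈.sym g⁻¹g) ⟩
      (g⁻¹ ∘ g) ∘ f   ≈⟨ pull gf≈k ⟩
      g⁻¹ ∘ k         ∎
    right : f ∘ (k⁻¹ ∘ g) ≈ id
    right = begin
      f ∘ (k⁻¹ ∘ g)         ≈⟨ ∘-congʳ f≈g⁻¹k ⟩
      (g⁻¹ ∘ k) ∘ (k⁻¹ ∘ g) ≈⟨ pull (≈.sym assoc) ⟩
      g⁻¹ ∘ ((k ∘ k⁻¹) ∘ g) ≈⟨ ∘-congˡ (≈.trans (∘-congʳ kk⁻¹) identityˡ) ⟩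
      g⁻¹ ∘ g               ≈⟨ g⁻¹g ⟩
      id                    ∎

  ≅-sym : ∀ {A B} → _≅_ 𝒞 A B → _≅_ 𝒞 B A
  ≅-sym (f , f⁻¹ , f⁻¹f , ff⁻¹) = f⁻¹ , f , ff⁻¹ , f⁻¹f

  ≅-trans : ∀ {A B C} → _≅_ 𝒞 A B → _≅_ 𝒞 B C → _≅_ 𝒞 A C
  ≅-trans (f , f-iso) (g , g-iso) = g ∘ f , iso-∘ f-iso g-iso

  module _ {A B C D} {f : Hom A B} {g : Hom A C} {i₁ : Hom B D} {i₂ : Hom C D}
           (po : IsPushout 𝒞 f g i₁ i₂) where
    open IsPushout po

    pushout-jointly-epic : ∀ {X} {w w′ : Hom D X} →
      w ∘ i₁ ≈ w′ ∘ i₁ → w ∘ i₂ ≈ w′ ∘ i₂ → w ≈ w′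
    pushout-jointly-epic {w = w} {w′} p q =
      ≈.trans (unique commute′ w ≈.refl ≈.refl) (≈.sym (unique commute′ w′ (≈.sym p) (≈.sym q)))
      where
      commute′ : (w ∘ i₁) ∘ f ≈ (w ∘ i₂) ∘ g
      commute′ = ≈.trans (pull commute) (≈.sym assoc)

    -- The pushout of an isomorphism is an isomorphism: if f is invertible,
    -- so is the opposite side i₂, with inverse induced by (g ∘ f⁻¹ , id).
    pushout-of-iso : IsIso 𝒞 f → IsIso 𝒞 i₂
    pushout-of-iso (f⁻¹ , f⁻¹f , ff⁻¹) = i₂⁻¹ , universal-β₂ cocone , i₂i₂⁻¹
      where
      cocone : (g ∘ f⁻¹) ∘ f ≈ id ∘ g
      cocone = ≈.trans (pull f⁻¹f) (≈.trans identityʳ (≈.sym identityˡ))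
      i₂⁻¹ : Hom D C
      i₂⁻¹ = universal (g ∘ f⁻¹) id cocone
      i₂i₂⁻¹ : i₂ ∘ i₂⁻¹ ≈ id
      i₂i₂⁻¹ = pushout-jointly-epic on-i₁ on-i₂
        where
        on-i₁ : (i₂ ∘ i₂⁻¹) ∘ i₁ ≈ id ∘ i₁
        on-i₁ = begin
          (i₂ ∘ i₂⁻¹) ∘ i₁ ≈⟨ pull (universal-β₁ cocone) ⟩
          i₂ ∘ (g ∘ f⁻¹)   ≈⟨ ≈.trans (≈.sym assoc) (∘-congʳ (≈.sym commute)) ⟩
          (i₁ ∘ f) ∘ f⁻¹   ≈⟨ pull ff⁻¹ ⟩
          i₁ ∘ id          ≈⟨ ≈.trans identityʳ (≈.sym identityˡ) ⟩
          id ∘ i₁          ∎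
        on-i₂ : (i₂ ∘ i₂⁻¹) ∘ i₂ ≈ id ∘ i₂
        on-i₂ = ≈.trans (pull (universal-β₂ cocone)) (≈.trans identityʳ (≈.sym identityˡ))

  pushout-resp-≈ : ∀ {A B C D} {f f′ : Hom A B} {g g′ : Hom A C}
    {i₁ i₁′ : Hom B D} {i₂ i₂′ : Hom C D} →
    f ≈ f′ → g ≈ g′ → i₁ ≈ i₁′ → i₂ ≈ i₂′ →
    IsPushout 𝒞 f g i₁ i₂ → IsPushout 𝒞 f′ g′ i₁′ i₂′
  pushout-resp-≈ {f = f} {f′} {g} {g′} f≈ g≈ i₁≈ i₂≈ po = record
    { commute      = ≈.trans (∘-resp-≈ (≈.sym i₁≈) (≈.sym f≈))
                       (≈.trans commute (∘-resp-≈ i₂≈ g≈))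
    ; universal    = λ u v eq → universal u v (back eq)
    ; universal-β₁ = λ eq → ≈.trans (∘-congˡ (≈.sym i₁≈)) (universal-β₁ (back eq))
    ; universal-β₂ = λ eq → ≈.trans (∘-congˡ (≈.sym i₂≈)) (universal-β₂ (back eq))
    ; unique       = λ eq w p q → unique (back eq) w
                       (≈.trans (∘-congˡ i₁≈) p) (≈.trans (∘-congˡ i₂≈) q)
    }
    where
    open IsPushout po
    back : ∀ {X} {u : Hom _ X} {v : Hom _ X} → u ∘ f′ ≈ v ∘ g′ → u ∘ f ≈ v ∘ g
    back eq = ≈.trans (∘-congˡ f≈) (≈.trans eq (∘-congˡ (≈.sym g≈)))

  pushout-paste : ∀ {A B C C′ D E} {f : Hom A B} {g : Hom A C}
    {i₁ : Hom B D} {i₂ : Hom C D} {g′ : Hom C C′} {j₁ : Hom C′ E} {j₂ : Hom D E} →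
    IsPushout 𝒞 f g i₁ i₂ → IsPushout 𝒞 g′ i₂ j₁ j₂ →
    IsPushout 𝒞 (g′ ∘ g) f j₁ (j₂ ∘ i₁)
  pushout-paste {f = f} {g} {i₁} {i₂} {g′} {j₁} {j₂} inner outer = record
    { commute      = commute′
    ; universal    = λ u v eq → Q.universal u (mid eq) (mid-cocone eq)
    ; universal-β₁ = λ eq → Q.universal-β₁ (mid-cocone eq)
    ; universal-β₂ = λ eq → ≈.trans (≈.sym assoc)
                       (≈.trans (∘-congʳ (Q.universal-β₂ (mid-cocone eq))) (P.universal-β₁ (flip eq)))
    ; unique       = unique′
    }
    where
    module P = IsPushout inner
    module Q = IsPushout outer

    commute′ : j₁ ∘ (g′ ∘ g) ≈ (j₂ ∘ i₁) ∘ f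
    commute′ = begin
      j₁ ∘ (g′ ∘ g)   ≈⟨ ≈.sym assoc ⟩
      (j₁ ∘ g′) ∘ g   ≈⟨ pull-through Q.commute ⟩
      j₂ ∘ (i₂ ∘ g)   ≈⟨ ∘-congˡ (≈.sym P.commute) ⟩
      j₂ ∘ (i₁ ∘ f)   ≈⟨ ≈.sym assoc ⟩
      (j₂ ∘ i₁) ∘ f   ∎

    module _ {X} {u : Hom _ X} {v : Hom _ X} (eq : u ∘ (g′ ∘ g) ≈ v ∘ f) where
      flip : v ∘ f ≈ (u ∘ g′) ∘ g
      flip = ≈.trans (≈.sym eq) (≈.sym assoc)

      mid : Hom _ X
      mid = P.universal v (u ∘ g′) flip

      mid-cocone : u ∘ g′ ≈ mid ∘ i₂
      mid-cocone = ≈.sym (P.universal-β₂ flip)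

    unique′ : ∀ {X} {u : Hom _ X} {v : Hom _ X} (eq : u ∘ (g′ ∘ g) ≈ v ∘ f) (w : Hom _ X) →
              w ∘ j₁ ≈ u → w ∘ (j₂ ∘ i₁) ≈ v → w ≈ Q.universal u (mid eq) (mid-cocone eq)
    unique′ {u = u} {v} eq w on-j₁ on-B =
      Q.unique (mid-cocone eq) w on-j₁ (P.unique (flip eq) (w ∘ j₂) on-i₁ on-i₂)
      where
      on-i₁ : (w ∘ j₂) ∘ i₁ ≈ v
      on-i₁ = ≈.trans assoc on-B
      on-i₂ : (w ∘ j₂) ∘ i₂ ≈ u ∘ g′
      on-i₂ = ≈.trans (pull (≈.sym Q.commute)) (≈.trans (≈.sym assoc) (∘-congʳ on-j₁))

  pushout-cancel : ∀ {A B B′ C D E} {f : Hom A B} {g : Hom A C}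
    {i₁ : Hom B D} {i₂ : Hom C D} {k : Hom B B′} {w : Hom D E} {j : Hom B′ E} →
    IsPushout 𝒞 f g i₁ i₂ → w ∘ i₁ ≈ j ∘ k →
    IsPushout 𝒞 (k ∘ f) g j (w ∘ i₂) → IsPushout 𝒞 i₁ k w j
  pushout-cancel {f = f} {g} {i₁} {i₂} {k} {w} {j} left square outer = record
    { commute      = square
    ; universal    = λ u v eq → O.universal v (u ∘ i₂) (cocone eq)
    ; universal-β₁ = on-w
    ; universal-β₂ = λ eq → O.universal-β₁ (cocone eq)
    ; unique       = λ eq z on-w′ on-j →
                       O.unique (cocone eq) z on-j (≈.trans (≈.sym assoc) (∘-congʳ on-w′))
    }
    where
    module P = IsPushout left
    module O = IsPushout outer

    module _ {X} {u : Hom _ X} {v : Hom _ X} (eq : u ∘ i₁ ≈ v ∘ k) where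
      cocone : v ∘ (k ∘ f) ≈ (u ∘ i₂) ∘ g
      cocone = begin
        v ∘ (k ∘ f)   ≈⟨ ≈.sym assoc ⟩
        (v ∘ k) ∘ f   ≈⟨ pull-through (≈.sym eq) ⟩
        u ∘ (i₁ ∘ f)  ≈⟨ ∘-congˡ P.commute ⟩
        u ∘ (i₂ ∘ g)  ≈⟨ ≈.sym assoc ⟩
        (u ∘ i₂) ∘ g  ∎

      on-w : O.universal v (u ∘ i₂) cocone ∘ w ≈ u
      on-w = pushout-jointly-epic left on-i₁ on-i₂
        where
        z : Hom _ X
        z = O.universal v (u ∘ i₂) cocone
        on-i₁ : (z ∘ w) ∘ i₁ ≈ u ∘ i₁
        on-i₁ = begin
          (z ∘ w) ∘ i₁  ≈⟨ pull square ⟩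
          z ∘ (j ∘ k)   ≈⟨ ≈.sym assoc ⟩
          (z ∘ j) ∘ k   ≈⟨ ∘-congʳ (O.universal-β₁ cocone) ⟩
          v ∘ k         ≈⟨ ≈.sym eq ⟩
          u ∘ i₁        ∎
        on-i₂ : (z ∘ w) ∘ i₂ ≈ u ∘ i₂
        on-i₂ = ≈.trans assoc (O.universal-β₂ cocone)

module PleomorphismFacts {o ℓ e o′ ℓ′ e′} (𝔏 : DiagrammaticLogic o ℓ e o′ ℓ′ e′) where
  open DiagrammaticLogic 𝔏
  open Category 𝒮
  open Functor 𝓛
  private
    module 𝒯 = CategoryFacts 𝒯

  -- In a commuting square g ∘ f ≈ k ∘ m whose sides g, k, m are
  -- pleomorphisms, the fourth side f is a pleomorphism too (2-out-of-3 for
  -- isomorphisms in 𝒯 after applying 𝓛).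
  pleo-square : ∀ {A B B′ C} {f : Hom A B} {g : Hom B C} {m : Hom A B′} {k : Hom B′ C} →
                IsPleomorphism g → IsPleomorphism k → IsPleomorphism m →
                g ∘ f ≈ k ∘ m → IsPleomorphism f
  pleo-square g-pleo k-pleo m-pleo square =
    𝒯.iso-cancelˡ g-pleo (𝒯.iso-∘ m-pleo k-pleo)
      (𝒯.≈.trans (𝒯.≈.sym homomorphism) (𝒯.≈.trans (F-resp-≈ square) homomorphism))

  -- The pushout of a pleomorphism is a pleomorphism: 𝓛 carries the pushout
  -- to a pushout in 𝒯, where the opposite side of an isomorphism is one.
  pleo-pushout : ∀ {A B C D} {f : Hom A B} {g : Hom A C} {i₁ : Hom B D} {i₂ : Hom C D} →
                 IsPushout 𝒮 f g i₁ i₂ → IsPleomorphism f → IsPleomorphism i₂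
  pleo-pushout po = 𝒯.pushout-of-iso (preserves-pushouts po)

  pleoequivalent-cospan : ∀ {X Y Z} {a : Hom X Z} {b : Hom Y Z} →
                          IsPleomorphism a → IsPleomorphism b → Pleoequivalent X Y
  pleoequivalent-cospan {a = a} {b} a-pleo b-pleo =
    𝒯.≅-trans (F₁ a , a-pleo) (𝒯.≅-sym (F₁ b , b-pleo))

theorem1 : {o ℓ e o′ ℓ′ e′ : Level} (𝔏 : DiagrammaticLogic o ℓ e o′ ℓ′ e′) →
    let open DiagrammaticLogic 𝔏 in
    let open Category 𝒮 in
    {K H C P : Obj} (l : Hom K H) (r : Hom K C) (c : Hom C P) (h : Hom H P) →
    IsPushout 𝒮 l r h c → IsPleomorphism h →
    {ΣK ΣH ΣC ΣP : Obj} (σH : Hom H ΣH) (σK : Hom K ΣK) (l₁ : Hom ΣK ΣH)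
    (r₁ : Hom ΣK ΣC) (σC : Hom C ΣC) →
    IsPleomorphism l₁ → l₁ ∘ σK ≈ σH ∘ l → IsPushout 𝒮 r σK σC r₁ →
    (h₁ : Hom ΣH ΣP) (c₁ : Hom ΣC ΣP) → IsPushout 𝒮 l₁ r₁ h₁ c₁ →
    Σ (Hom P ΣP) λ σP →
      ((σP ∘ h ≈ h₁ ∘ σH) × (σP ∘ c ≈ c₁ ∘ σC))
      × (∀ (τ : Hom P ΣP) → τ ∘ h ≈ h₁ ∘ σH → τ ∘ c ≈ c₁ ∘ σC → τ ≈ σP)
      × (IsPushout 𝒮 l r h c × IsPushout 𝒮 l₁ r₁ h₁ c₁
         × IsPushout 𝒮 r σK σC r₁ × IsPushout 𝒮 h σH σP h₁)
      × (IsPleomorphism h × IsPleomorphism l₁ × IsPleomorphism r₁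
         × IsPleomorphism h₁ × IsPleomorphism c₁)
      × (∀ (Σ′ : Obj) → IsInstanceIn σH Σ′ → IsInstanceIn σC Σ′)
theorem1 𝔏 {P = P} l r c h rule h-pleo {ΣP = ΣP} σH σK l₁ r₁ σC l₁-pleo σ-square σ-pushout h₁ c₁ Σ-pushout =
  σP , (σP∘h , σP∘c) , IsPushout.unique rule cocone
     , (rule , Σ-pushout , σ-pushout , σP-square)
     , (h-pleo , l₁-pleo , r₁-pleo , h₁-pleo , c₁-pleo)
     , λ Σ′ σH-instance → 𝒯.≅-trans (pleoequivalent-cospan c₁-pleo h₁-pleo) σH-instance
  where
  open DiagrammaticLogic 𝔏
  open Category 𝒮
  open CategoryFacts 𝒮
  open PleomorphismFacts 𝔏
  module 𝒯 = CategoryFacts 𝒯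

  rectangle : IsPushout 𝒮 (σH ∘ l) r h₁ (c₁ ∘ σC)
  rectangle = pushout-resp-≈ σ-square ≈.refl ≈.refl ≈.refl (pushout-paste σ-pushout Σ-pushout)

  -- Both Σ-squares commute, so (h₁ ∘ σH , c₁ ∘ σC) is a cocone under (l , r)
  -- and induces σP out of the pushout P.
  cocone : (h₁ ∘ σH) ∘ l ≈ (c₁ ∘ σC) ∘ r
  cocone = ≈.trans assoc (IsPushout.commute rectangle)

  σP : Hom P ΣP
  σP = IsPushout.universal rule (h₁ ∘ σH) (c₁ ∘ σC) cocone
  σP∘h : σP ∘ h ≈ h₁ ∘ σH
  σP∘h = IsPushout.universal-β₁ rule cocone
  σP∘c : σP ∘ c ≈ c₁ ∘ σC
  σP∘c = IsPushout.universal-β₂ rule cocone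

  σP-square : IsPushout 𝒮 h σH σP h₁
  σP-square = pushout-cancel rule σP∘h
    (pushout-resp-≈ ≈.refl ≈.refl ≈.refl (≈.sym σP∘c) rectangle)

  h₁-pleo : IsPleomorphism h₁
  h₁-pleo = pleo-pushout σP-square h-pleo
  c₁-pleo : IsPleomorphism c₁
  c₁-pleo = pleo-pushout Σ-pushout l₁-pleo
  r₁-pleo : IsPleomorphism r₁
  r₁-pleo = pleo-square c₁-pleo h₁-pleo l₁-pleo (≈.sym (IsPushout.commute Σ-pushout))
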